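{- If $\Gamma\vdash s=t$ in $\mathrm{Catt}_{\mathrm{su}}$, then $\mathrm{supp}(s)=\mathrm{supp}(t)$ (supports taken in $\Gamma$).
   Context: The type theory $\mathrm{Catt}_{\mathrm{su}}$. Fix an infinite set $V$ of variables containing distinct $d_i,d_i'$ ($i\in\mathbb N$). Raw syntax: contexts $\Gamma::=\emptyset\mid\Gamma,x:A$; types $A::=\star\mid s\to_A t$; terms $t::=x\mid\mathsf{coh}(\Gamma:A)[\sigma]$; substitutions $\sigma::=\langle\rangle\mid\langle\sigma,x\mapsto t\rangle$. $\equiv$ is syntactic equality up to $\alpha$-equivalence; $\mathrm{FV}$ free variables ($\mathrm{FV}(\mathsf{coh}(\Gamma:A)[\sigma])=\mathrm{FV}(\sigma)$, the union over the entries of $\sigma$; $\mathrm{FV}(\Gamma)$ the variables of $\Gamma$). Substitution: $\star[\sigma]=\star$, $(s\to_A t)[\sigma]=s[\sigma]\to_{A[\sigma]}t[\sigma]$, $x[\sigma]$ the entry for $x$, $\mathsf{coh}(\Gamma:A)[\tau][\sigma]=\mathsf{coh}(\Gamma:A)[\tau\circ\sigma]$, $\langle\rangle\circ\sigma=\langle\rangle$, $\langle\tau,x\mapsto t\rangle\circ\sigma=\langle\tau\circ\sigma,x\mapsto t[\sigma]\rangle$. $\dim\star=-1$, $\dim(s\to_A t)=\dim A+1$, variable $x:A$ has dimension $\dim A+1$, $\dim\emptyset=-1$, $\dim(\Gamma,x:A)=\max(\dim\Gamma,\dim A+1)$. Support: $\mathrm{supp}(t)$ in $\Gamma$ is the smallest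 set of variables containing $\mathrm{FV}(t)$ and containing $\mathrm{FV}(A)$ whenever it contains $x$ with $(x:A)\in\Gamma$. Typing: $\emptyset\vdash$; $\Gamma,x:A\vdash$ from $\Gamma\vdash A$; $\Gamma\vdash\star$; $\Gamma\vdash s\to_A t$ from $\Gamma\vdash A,\Gamma\vdash s:A,\Gamma\vdash t:A$; $\Gamma\vdash\langle\rangle:\emptyset$; $\Gamma\vdash\langle\sigma,x\mapsto t\rangle:(\Delta,x:A)$ from $\Gamma\vdash\sigma:\Delta,\Delta\vdash A,\Gamma\vdash t:A[\sigma]$; $\Gamma\vdash x:A$ for $(x:A)\in\Gamma$; conversion; coherence rule: if $\Gamma\vdash_p$, $\Gamma\vdash s\to_A t$, $\Delta\vdash\sigma:\Gamma$, and either ($\mathrm{supp}(s)=\partial^-(\Gamma)$, $\mathrm{supp}(t)=\partial^+(\Gamma)$) or $\mathrm{supp}(s)=\mathrm{supp}(t)=\mathrm{FV}(\Gamma)$, then $\Delta\vdash\mathsf{coh}(\Gamma:s\to_A t)[\sigma]:s[\sigma]\to_{A[\sigma]}t[\sigma]$. Pasting contexts: $(x:\star)\vdash_p x:\star$; $\Gamma\vdash_p x:A\Rightarrow\Gamma,y:A,f:x\to_A y\vdash_p f:x\to_A y$ (introduction); $\Gamma\vdash_p f:x\to_A y\Rightarrow\Gamma\vdash_p y:A$ (descent); $\Gamma\vdash_p$ if $\Gamma\vdash_p x:\star$. $\partial^\mp(\Gamma)$: variables of dimension $<\dim\Gamma-1$ plus those of dimension $\dim\Gamma-1$ not the target (resp.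 source) of another variable. Discs: $D^0=(d_0:\star)$, $S^{ -1}=\star$, $D^{k+1}=D^k,(d_k':S^{k-1}),(d_{k+1}:S^k)$, $S^k=d_k\to_{S^{k-1}}d_k'$; $\mathsf{i}_k:=\mathsf{coh}(D^k:d_k\to_{S^{k-1}}d_k)[\mathrm{id}_{D^k}]$; identity terms: syntactically $\mathsf{i}_k[\tau]$. $\{\star,t\}=\langle t\rangle$, $\{u\to_A v,t\}=\langle\{A,u\},v,t\rangle$. Locally maximal variables of pasting $\Delta$: introduced by an introduction step immediately followed by a descent step; for such $\alpha:s\to_A t$, $\Delta/\!\!/\alpha$ deletes $t,\alpha$; $\pi_\alpha$ sends $\alpha\mapsto\mathsf{i}_{\dim A+1}[\{A,s\}]$, $t\mapsto s$, others fixed; $\sigma/\!\!/\alpha$ removes entries for $t,\alpha$. Definitional equality $\Gamma\vdash s=t$: smallest relation containing $x=x$ for variables of $\Gamma$, closed under symmetry, transitivity and congruence for $\mathsf{coh}$, generated by (prune) $\mathsf{coh}(\Delta:A)[\sigma]=\mathsf{coh}(\Delta/\!\!/\alpha:A[\pi_\alpha])[\sigma/\!\!/\alpha]$ if the left side is well typed in $\Gamma$, $\alpha$ locally maximal, $\alpha[\sigma]$ an identity; (disc) $\mathsf{coh}(D^{n+1}:S^n)[\sigma]=d_{n+1}[\sigma]$ when well typed; (endo) $\mathsf{coh}(\Delta:t\to_A t)[\sigma]=\mathsf{i}_{\dim A+1}[\{A,t\}\circ\sigma]$ when well typed; induced componentwise on types and substitutions. -}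

module Defs where

-- Catt_su, in well-scoped de Bruijn-index syntax (so syntactic equality
-- ≡ is automatically equality up to α-equivalence).  Index `zero` is the
-- LAST variable of a context.

open import Data.Nat using (ℕ; zero; suc)
open import Data.Fin using (Fin; zero; suc)
open import Data.Integer using (ℤ; _+_; _-_; _<_; _⊔_; -[1+_]; +_)
open import Data.Product using (Σ; ∃; _×_; _,_)
open import Data.Sum using (_⊎_)
open import Data.Unit using (⊤)
open import Relation.Binary.PropositionalEquality using (_≡_)
open import Relation.Nullary using (¬_)

mutual
  data Ty (n : ℕ) : Set where
    ⋆     : Ty n
    _─⟨_⟩⟶_ : Tm n → Ty n → Tm n → Ty n

  data Tm (n : ℕ) : Set where
    var : Fin n → Tm n
    coh : {k : ℕ} → Ctx k → Ty k → Sub k n → Tm n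

  -- Sub k n : substitution from a context with k variables,
  -- with terms in scope n.  ⟨ σ , t ⟩ gives the entry for the last variable.
  data Sub : ℕ → ℕ → Set where
    ⟨⟩    : {n : ℕ} → Sub zero n
    ⟨_,_⟩ : {k n : ℕ} → Sub k n → Tm n → Sub (suc k) n

  data Ctx : ℕ → Set where
    ∅   : Ctx zero
    _▸_ : {n : ℕ} → Ctx n → Ty n → Ctx (suc n)

infixl 5 _▸_

mutual
  renTm : {n m : ℕ} → (Fin n → Fin m) → Tm n → Tm m
  renTm ρ (var x) = var (ρ x)
  renTm ρ (coh Δ A σ) = coh Δ A (renSub ρ σ)

  renTy : {n m : ℕ} → (Fin n → Fin m) → Ty n → Ty m
  renTy ρ ⋆ = ⋆
  renTy ρ (s ─⟨ A ⟩⟶ t) = renTm ρ s ─⟨ renTy ρ A ⟩⟶ renTm ρ t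

  renSub : {k n m : ℕ} → (Fin n → Fin m) → Sub k n → Sub k m
  renSub ρ ⟨⟩ = ⟨⟩
  renSub ρ ⟨ σ , t ⟩ = ⟨ renSub ρ σ , renTm ρ t ⟩

wkTm : {n : ℕ} → Tm n → Tm (suc n)
wkTm = renTm suc

wkTy : {n : ℕ} → Ty n → Ty (suc n)
wkTy = renTy suc

wkSub : {k n : ℕ} → Sub k n → Sub k (suc n)
wkSub = renSub suc

lookupSub : {k n : ℕ} → Sub k n → Fin k → Tm n
lookupSub ⟨ σ , t ⟩ zero = t
lookupSub ⟨ σ , t ⟩ (suc i) = lookupSub σ i

mutual
  _[_]tm : {k n : ℕ} → Tm k → Sub k n → Tm n
  var x [ σ ]tm = lookupSub σ x
  coh Δ A τ [ σ ]tm = coh Δ A (τ ∘ σ)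

  _∘_ : {j k n : ℕ} → Sub j k → Sub k n → Sub j n
  ⟨⟩ ∘ σ = ⟨⟩
  ⟨ τ , t ⟩ ∘ σ = ⟨ τ ∘ σ , t [ σ ]tm ⟩

_[_]ty : {k n : ℕ} → Ty k → Sub k n → Ty n
⋆ [ σ ]ty = ⋆
(s ─⟨ A ⟩⟶ t) [ σ ]ty = (s [ σ ]tm) ─⟨ A [ σ ]ty ⟩⟶ (t [ σ ]tm)

idSub : (n : ℕ) → Sub n n
idSub zero = ⟨⟩
idSub (suc n) = ⟨ wkSub (idSub n) , var zero ⟩

liftSub : {k n : ℕ} → Sub k n → Sub (suc k) (suc n)
liftSub σ = ⟨ wkSub σ , var zero ⟩

varTy : {n : ℕ} → Ctx n → Fin n → Ty n
varTy (Γ ▸ A) zero = wkTy A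
varTy (Γ ▸ A) (suc x) = wkTy (varTy Γ x)

dimTy : {n : ℕ} → Ty n → ℤ
dimTy ⋆ = -[1+ 0 ]
dimTy (s ─⟨ A ⟩⟶ t) = dimTy A + + 1

dimVar : {n : ℕ} → Ctx n → Fin n → ℤ
dimVar Γ x = dimTy (varTy Γ x) + + 1

dimCtx : {n : ℕ} → Ctx n → ℤ
dimCtx ∅ = -[1+ 0 ]
dimCtx (Γ ▸ A) = dimCtx Γ ⊔ (dimTy A + + 1)

-- dim A + 1 as a natural number (index of the disc D^{dim A + 1})
discLevel : {n : ℕ} → Ty n → ℕ
discLevel ⋆ = zero
discLevel (s ─⟨ A ⟩⟶ t) = suc (discLevel A)

mutual
  data _∈FVtm_ {n : ℕ} (x : Fin n) : Tm n → Set where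
    fv-var : x ∈FVtm var x
    fv-coh : {k : ℕ} {Δ : Ctx k} {A : Ty k} {σ : Sub k n} →
             x ∈FVsub σ → x ∈FVtm coh Δ A σ

  data _∈FVsub_ {n : ℕ} (x : Fin n) : {k : ℕ} → Sub k n → Set where
    fv-here  : {k : ℕ} {σ : Sub k n} {t : Tm n} → x ∈FVtm t → x ∈FVsub ⟨ σ , t ⟩
    fv-there : {k : ℕ} {σ : Sub k n} {t : Tm n} → x ∈FVsub σ → x ∈FVsub ⟨ σ , t ⟩

data _∈FVty_ {n : ℕ} (x : Fin n) : Ty n → Set where
  fv-src : {s t : Tm n} {A : Ty n} → x ∈FVtm s → x ∈FVty (s ─⟨ A ⟩⟶ t)
  fv-ty  : {s t : Tm n} {A : Ty n} → x ∈FVty A → x ∈FVty (s ─⟨ A ⟩⟶ t)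
  fv-tgt : {s t : Tm n} {A : Ty n} → x ∈FVtm t → x ∈FVty (s ─⟨ A ⟩⟶ t)

data Supp {n : ℕ} (Γ : Ctx n) (t : Tm n) : Fin n → Set where
  supp-fv : {x : Fin n} → x ∈FVtm t → Supp Γ t x
  supp-ty : {x y : Fin n} → Supp Γ t x → y ∈FVty varTy Γ x → Supp Γ t y

_≐_ : {n : ℕ} → (Fin n → Set) → (Fin n → Set) → Set
P ≐ Q = ∀ x → (P x → Q x) × (Q x → P x)

IsTargetOfSome : {n : ℕ} → Ctx n → Fin n → Set
IsTargetOfSome Γ x =
  Σ _ λ y → Σ _ λ s → Σ _ λ B → varTy Γ y ≡ (s ─⟨ B ⟩⟶ var x)

IsSourceOfSome : {n : ℕ} → Ctx n → Fin n → Set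
IsSourceOfSome Γ x =
  Σ _ λ y → Σ _ λ t → Σ _ λ B → varTy Γ y ≡ (var x ─⟨ B ⟩⟶ t)

∂⁻ : {n : ℕ} → Ctx n → Fin n → Set
∂⁻ Γ x = (dimVar Γ x < dimCtx Γ - + 1)
       ⊎ ((dimVar Γ x ≡ dimCtx Γ - + 1) × ¬ IsTargetOfSome Γ x)

∂⁺ : {n : ℕ} → Ctx n → Fin n → Set
∂⁺ Γ x = (dimVar Γ x < dimCtx Γ - + 1)
       ⊎ ((dimVar Γ x ≡ dimCtx Γ - + 1) × ¬ IsSourceOfSome Γ x)

data _⊢p_∶_ : {n : ℕ} → Ctx n → Tm n → Ty n → Set where
  ps-base    : (∅ ▸ ⋆) ⊢p var zero ∶ ⋆
  ps-intro   : {n : ℕ} {Γ : Ctx n} {x : Tm n} {A : Ty n} →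
               Γ ⊢p x ∶ A →
               (Γ ▸ A ▸ (wkTm x ─⟨ wkTy A ⟩⟶ var zero))
                 ⊢p var zero ∶ (wkTm (wkTm x) ─⟨ wkTy (wkTy A) ⟩⟶ var (suc zero))
  ps-descent : {n : ℕ} {Γ : Ctx n} {f x y : Tm n} {A : Ty n} →
               Γ ⊢p f ∶ (x ─⟨ A ⟩⟶ y) → Γ ⊢p y ∶ A

data _⊢pc {n : ℕ} (Γ : Ctx n) : Set where
  pasting : {x : Tm n} → Γ ⊢p x ∶ ⋆ → Γ ⊢pc

-- number of variables of D^k is 2k+1
double : ℕ → ℕ
double zero = zero
double (suc k) = suc (suc (double k))

discSize : ℕ → ℕ
discSize k = suc (double k)

mutual
  Disc : (k : ℕ) → Ctx (discSize k)
  Disc zero = ∅ ▸ ⋆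
  Disc (suc k) = Disc k ▸ sphere k ▸ (var (suc zero) ─⟨ wkTy (sphere k) ⟩⟶ var zero)

  -- S^{k-1}, as a type in D^k (the type of d_k)
  sphere : (k : ℕ) → Ty (discSize k)
  sphere zero = ⋆
  sphere (suc k) = var (suc (suc zero)) ─⟨ wkTy (wkTy (sphere k)) ⟩⟶ var (suc zero)

idTm : {n : ℕ} (k : ℕ) → Sub (discSize k) n → Tm n
idTm k τ = coh (Disc k) (var zero ─⟨ sphere k ⟩⟶ var zero) τ

IsIdentity : {n : ℕ} → Tm n → Set
IsIdentity t = Σ ℕ λ k → Σ _ λ τ → t ≡ idTm k τ

discSub : {n : ℕ} (A : Ty n) → Tm n → Sub (discSize (discLevel A)) n
discSub ⋆ t = ⟨ ⟨⟩ , t ⟩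
discSub (u ─⟨ A ⟩⟶ v) t = ⟨ ⟨ discSub A u , v ⟩ , t ⟩

data LocMax : {n : ℕ} {Γ : Ctx n} {x : Tm n} {A : Ty n} →
              Γ ⊢p x ∶ A → Fin n → Set where
  lm-here : {n : ℕ} {Γ : Ctx n} {x : Tm n} {A : Ty n} (D : Γ ⊢p x ∶ A) →
            LocMax (ps-descent (ps-intro D)) zero
  lm-desc : {n : ℕ} {Γ : Ctx n} {f x y : Tm n} {A : Ty n}
            {D : Γ ⊢p f ∶ (x ─⟨ A ⟩⟶ y)} {α : Fin n} →
            LocMax D α → LocMax (ps-descent D) α
  lm-intro : {n : ℕ} {Γ : Ctx n} {x : Tm n} {A : Ty n}
             {D : Γ ⊢p x ∶ A} {α : Fin n} →
             LocMax D α → LocMax (ps-intro D) (suc (suc α))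

LocMaxPC : {n : ℕ} {Γ : Ctx n} → Γ ⊢pc → Fin n → Set
LocMaxPC (pasting D) α = LocMax D α

-- For α : s →_A t locally maximal: size of Δ//α, the context Δ//α,
-- the substitution π_α (α ↦ i[{A,s}], t ↦ s, other variables fixed),
-- and σ//α (drop the entries of t and α).
-- Δ//α deletes t and α; in the types of later variables t is replaced by s
-- (i.e. they are substituted along π_α).

prSize : {n : ℕ} {Γ : Ctx n} {x : Tm n} {A : Ty n} {D : Γ ⊢p x ∶ A} {α : Fin n} →
         LocMax D α → ℕ
prSize (lm-here {n = n} D) = n
prSize (lm-desc lm) = prSize lm
prSize (lm-intro lm) = suc (suc (prSize lm))

prπ : {n : ℕ} {Γ : Ctx n} {x : Tm n} {A : Ty n} {D : Γ ⊢p x ∶ A} {α : Fin n} →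
      (lm : LocMax D α) → Sub n (prSize lm)
prπ (lm-here {n = n} {x = s} {A = A} D) =
  ⟨ ⟨ idSub n , s ⟩ , idTm (discLevel A) (discSub A s) ⟩
prπ (lm-desc lm) = prπ lm
prπ (lm-intro lm) = liftSub (liftSub (prπ lm))

prCtx : {n : ℕ} {Γ : Ctx n} {x : Tm n} {A : Ty n} {D : Γ ⊢p x ∶ A} {α : Fin n} →
        (lm : LocMax D α) → Ctx (prSize lm)
prCtx (lm-here {Γ = Γ} D) = Γ
prCtx (lm-desc lm) = prCtx lm
prCtx (lm-intro {x = x} {A = A} lm) =
  prCtx lm ▸ A [ prπ lm ]ty ▸ (wkTm x ─⟨ wkTy A ⟩⟶ var zero) [ liftSub (prπ lm) ]ty

prSub : {n m : ℕ} {Γ : Ctx n} {x : Tm n} {A : Ty n} {D : Γ ⊢p x ∶ A} {α : Fin n} →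
        (lm : LocMax D α) → Sub n m → Sub (prSize lm) m
prSub (lm-here D) ⟨ ⟨ σ , _ ⟩ , _ ⟩ = σ
prSub (lm-desc lm) σ = prSub lm σ
prSub (lm-intro lm) ⟨ ⟨ σ , u ⟩ , v ⟩ = ⟨ ⟨ prSub lm σ , u ⟩ , v ⟩

infix 4 _⊢ctx _⊢ty_ _⊢_∶_ _⊢sub_∶_ _⊢_≈_ _⊢ty_≈_ _⊢sub_≈_

mutual
  data _⊢ctx : {n : ℕ} → Ctx n → Set where
    ctx-∅ : ∅ ⊢ctx
    ctx-, : {n : ℕ} {Γ : Ctx n} {A : Ty n} → Γ ⊢ty A → (Γ ▸ A) ⊢ctx

  data _⊢ty_ {n : ℕ} (Γ : Ctx n) : Ty n → Set where
    ty-⋆   : Γ ⊢ty ⋆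
    ty-arr : {s t : Tm n} {A : Ty n} →
             Γ ⊢ty A → Γ ⊢ s ∶ A → Γ ⊢ t ∶ A → Γ ⊢ty (s ─⟨ A ⟩⟶ t)

  data _⊢sub_∶_ {m : ℕ} (Γ : Ctx m) : {n : ℕ} → Sub n m → Ctx n → Set where
    sub-⟨⟩ : Γ ⊢sub ⟨⟩ ∶ ∅
    sub-ext : {n : ℕ} {σ : Sub n m} {Δ : Ctx n} {A : Ty n} {t : Tm m} →
              Γ ⊢sub σ ∶ Δ → Δ ⊢ty A → Γ ⊢ t ∶ (A [ σ ]ty) →
              Γ ⊢sub ⟨ σ , t ⟩ ∶ (Δ ▸ A)

  data _⊢_∶_ {n : ℕ} (Γ : Ctx n) : Tm n → Ty n → Set where
    tm-var  : (x : Fin n) → Γ ⊢ var x ∶ varTy Γ x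
    tm-conv : {t : Tm n} {A B : Ty n} → Γ ⊢ t ∶ A → Γ ⊢ty A ≈ B → Γ ⊢ t ∶ B
    tm-coh  : {k : ℕ} {Δ : Ctx k} {s t : Tm k} {A : Ty k} {σ : Sub k n} →
              Δ ⊢pc → Δ ⊢ty (s ─⟨ A ⟩⟶ t) → Γ ⊢sub σ ∶ Δ →
              ((Supp Δ s ≐ ∂⁻ Δ) × (Supp Δ t ≐ ∂⁺ Δ))
                ⊎ ((Supp Δ s ≐ (λ _ → ⊤)) × (Supp Δ t ≐ (λ _ → ⊤))) →
              Γ ⊢ coh Δ (s ─⟨ A ⟩⟶ t) σ ∶ ((s [ σ ]tm) ─⟨ A [ σ ]ty ⟩⟶ (t [ σ ]tm))

  data _⊢_≈_ {n : ℕ} (Γ : Ctx n) : Tm n → Tm n → Set where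
    eq-var   : (x : Fin n) → Γ ⊢ var x ≈ var x
    eq-sym   : {s t : Tm n} → Γ ⊢ s ≈ t → Γ ⊢ t ≈ s
    eq-trans : {s t u : Tm n} → Γ ⊢ s ≈ t → Γ ⊢ t ≈ u → Γ ⊢ s ≈ u
    eq-coh   : {k : ℕ} {Δ : Ctx k} {A B : Ty k} {σ τ : Sub k n} →
               Δ ⊢ty A ≈ B → Γ ⊢sub σ ≈ τ → Γ ⊢ coh Δ A σ ≈ coh Δ B τ
    eq-prune : {k : ℕ} {Δ : Ctx k} {A : Ty k} {σ : Sub k n} →
               (Σ (Ty n) λ B → Γ ⊢ coh Δ A σ ∶ B) →
               (p : Δ ⊢pc) {α : Fin k} (lm : LocMaxPC p α) →
               IsIdentity (var α [ σ ]tm) →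
               Γ ⊢ coh Δ A σ ≈ coh (prCtxPC p lm) (A [ prπPC p lm ]ty) (prSubPC p lm σ)
    eq-disc  : {m : ℕ} {σ : Sub (discSize (suc m)) n} →
               (Σ (Ty n) λ B → Γ ⊢ coh (Disc (suc m)) (sphere (suc m)) σ ∶ B) →
               Γ ⊢ coh (Disc (suc m)) (sphere (suc m)) σ ≈ (var zero [ σ ]tm)
    eq-endo  : {k : ℕ} {Δ : Ctx k} {t : Tm k} {A : Ty k} {σ : Sub k n} →
               (Σ (Ty n) λ B → Γ ⊢ coh Δ (t ─⟨ A ⟩⟶ t) σ ∶ B) →
               Γ ⊢ coh Δ (t ─⟨ A ⟩⟶ t) σ ≈ idTm (discLevel A) (discSub A t ∘ σ)

  data _⊢ty_≈_ {n : ℕ} (Γ : Ctx n) : Ty n → Ty n → Set where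
    tyeq-⋆   : Γ ⊢ty ⋆ ≈ ⋆
    tyeq-arr : {s s' t t' : Tm n} {A A' : Ty n} →
               Γ ⊢ s ≈ s' → Γ ⊢ty A ≈ A' → Γ ⊢ t ≈ t' →
               Γ ⊢ty (s ─⟨ A ⟩⟶ t) ≈ (s' ─⟨ A' ⟩⟶ t')

  data _⊢sub_≈_ {n : ℕ} (Γ : Ctx n) : {k : ℕ} → Sub k n → Sub k n → Set where
    subeq-⟨⟩  : Γ ⊢sub ⟨⟩ ≈ ⟨⟩
    subeq-ext : {k : ℕ} {σ τ : Sub k n} {s t : Tm n} →
                Γ ⊢sub σ ≈ τ → Γ ⊢ s ≈ t → Γ ⊢sub ⟨ σ , s ⟩ ≈ ⟨ τ , t ⟩

  prSizePC : {k : ℕ} {Δ : Ctx k} (p : Δ ⊢pc) {α : Fin k} → LocMaxPC p α → ℕ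
  prSizePC (pasting D) lm = prSize lm

  prCtxPC : {k : ℕ} {Δ : Ctx k} (p : Δ ⊢pc) {α : Fin k} (lm : LocMaxPC p α) →
            Ctx (prSizePC p lm)
  prCtxPC (pasting D) lm = prCtx lm

  prπPC : {k : ℕ} {Δ : Ctx k} (p : Δ ⊢pc) {α : Fin k} (lm : LocMaxPC p α) →
          Sub k (prSizePC p lm)
  prπPC (pasting D) lm = prπ lm

  prSubPC : {k n : ℕ} {Δ : Ctx k} (p : Δ ⊢pc) {α : Fin k} (lm : LocMaxPC p α) →
            Sub k n → Sub (prSizePC p lm) n
  prSubPC (pasting D) lm σ = prSub lm σ

module Submission where

-- Write Cl_Γ(P) for the closure of a set P of variables under adding FV(A)
-- for each x : A in Γ, so that supp(t) = Cl_Γ(FV t).  One mutual induction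
-- over typing and equality derivations proves
--   * for Γ ⊢ t ∶ A, the type A agrees in support, componentwise, with the
--     type t carries syntactically; for a coherence t we also record the
--     premises of the coherence rule and the same facts for the entries of
--     its substitution (the invariant Info);
--   * Γ ⊢ s = t implies Cl_Γ(FV s) = Cl_Γ(FV t).
-- Symmetry, transitivity and congruence are immediate; each generating rule
-- is a lemma proved before the induction:
--   (disc)  a well-typed substitution out of a disc is supported by its top entry;
--   (endo)  ∂⁻Δ ≠ ∂⁺Δ for a pasting context Δ, so a coherence t → t has
--           supp(t) = FV(Δ), and σ is supported by t[σ];
--   (prune) the entries deleted by pruning α are supported by the entry of
--           the source of α, which is kept, because α[σ] is an identity.

open import Defs
open import Data.Nat using (ℕ; zero; suc; _⊔_; _≤_; _<_; _≤?_)
import Data.Nat.Properties as ℕ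
open import Data.Integer using (+_; -[1+_])
import Data.Integer as Z
import Data.Integer.Properties as ZP
open import Data.Fin using (Fin; zero; suc)
open import Data.Product using (Σ; _×_; _,_; proj₁; proj₂)
open import Data.Sum using (_⊎_; inj₁; inj₂)
open import Data.Unit using (⊤; tt)
open import Data.Empty using (⊥; ⊥-elim)
open import Level using (0ℓ)
open import Relation.Binary.PropositionalEquality
  using (_≡_; refl; sym; trans; cong; cong₂; subst; subst₂; module ≡-Reasoning)
open import Relation.Nullary using (¬_; yes; no)
open import Relation.Unary using (Pred; _⊆_)

variable
  n m k j : ℕ

VarSet : ℕ → Set₁
VarSet n = Pred (Fin n) 0ℓ

FV : Tm n → VarSet n
FV t x = x ∈FVtm t

FVsub : Sub k n → VarSet n
FVsub σ x = x ∈FVsub σ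

FVty : Ty n → VarSet n
FVty A x = x ∈FVty A

data Closure (Γ : Ctx n) (P : VarSet n) : VarSet n where
  cl-in : {x : Fin n} → P x → Closure Γ P x
  cl-ty : {x y : Fin n} → Closure Γ P x → y ∈FVty varTy Γ x → Closure Γ P y

SameSupp : Ctx n → VarSet n → VarSet n → Set
SameSupp Γ P Q = Closure Γ P ≐ Closure Γ Q

≐-refl : {P : VarSet n} → P ≐ P
≐-refl x = (λ p → p) , (λ p → p)

≐-sym : {P Q : VarSet n} → P ≐ Q → Q ≐ P
≐-sym e x = proj₂ (e x) , proj₁ (e x)

≐-trans : {P Q R : VarSet n} → P ≐ Q → Q ≐ R → P ≐ R
≐-trans e f x = (λ p → proj₁ (f x) (proj₁ (e x) p)) , (λ r → proj₂ (e x) (proj₂ (f x) r))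

module _ {Γ : Ctx n} where

  closure-bind : {P Q : VarSet n} → P ⊆ Closure Γ Q → Closure Γ P ⊆ Closure Γ Q
  closure-bind f (cl-in p) = f p
  closure-bind f (cl-ty c q) = cl-ty (closure-bind f c) q

  closure-mono : {P Q : VarSet n} → P ⊆ Q → Closure Γ P ⊆ Closure Γ Q
  closure-mono f = closure-bind (λ p → cl-in (f p))

  sameSupp : {P Q : VarSet n} → P ⊆ Closure Γ Q → Q ⊆ Closure Γ P → SameSupp Γ P Q
  sameSupp f g x = closure-bind f , closure-bind g

  sameSupp⇒⊆ : {P Q : VarSet n} → SameSupp Γ P Q → P ⊆ Closure Γ Q
  sameSupp⇒⊆ e p = proj₁ (e _) (cl-in p)

  supp⇒closure : {t : Tm n} → Supp Γ t ⊆ Closure Γ (FV t)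
  supp⇒closure (supp-fv p) = cl-in p
  supp⇒closure (supp-ty s q) = cl-ty (supp⇒closure s) q

  closure⇒supp : {t : Tm n} → Closure Γ (FV t) ⊆ Supp Γ t
  closure⇒supp (cl-in p) = supp-fv p
  closure⇒supp (cl-ty s q) = supp-ty (closure⇒supp s) q

mutual
  wk-[]tm : (u : Tm k) (σ : Sub k n) (t : Tm n) → wkTm u [ ⟨ σ , t ⟩ ]tm ≡ u [ σ ]tm
  wk-[]tm (var x) σ t = refl
  wk-[]tm (coh Δ A τ) σ t = cong (coh Δ A) (wk-∘ τ σ t)

  wk-∘ : (τ : Sub j k) (σ : Sub k n) (t : Tm n) → wkSub τ ∘ ⟨ σ , t ⟩ ≡ τ ∘ σ
  wk-∘ ⟨⟩ σ t = refl
  wk-∘ ⟨ τ , u ⟩ σ t = cong₂ ⟨_,_⟩ (wk-∘ τ σ t) (wk-[]tm u σ t)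

wk-[]ty : (A : Ty k) (σ : Sub k n) (t : Tm n) → wkTy A [ ⟨ σ , t ⟩ ]ty ≡ A [ σ ]ty
wk-[]ty ⋆ σ t = refl
wk-[]ty (s ─⟨ A ⟩⟶ u) σ t
  rewrite wk-[]tm s σ t | wk-[]ty A σ t | wk-[]tm u σ t = refl

wk²-[]ty : (A : Ty k) (σ : Sub k n) (a b : Tm n) →
           wkTy (wkTy A) [ ⟨ ⟨ σ , a ⟩ , b ⟩ ]ty ≡ A [ σ ]ty
wk²-[]ty A σ a b = trans (wk-[]ty (wkTy A) ⟨ σ , a ⟩ b) (wk-[]ty A σ a)

fv-lookup : (σ : Sub k n) (y : Fin k) → FV (lookupSub σ y) ⊆ FVsub σ
fv-lookup ⟨ σ , t ⟩ zero p = fv-here p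
fv-lookup ⟨ σ , t ⟩ (suc y) p = fv-there (fv-lookup σ y p)

mutual
  fv-[]tm : (u : Tm k) (σ : Sub k n) → FV (u [ σ ]tm) ⊆ FVsub σ
  fv-[]tm (var y) σ p = fv-lookup σ y p
  fv-[]tm (coh Δ A τ) σ (fv-coh p) = fv-∘ τ σ p

  fv-∘ : (τ : Sub j k) (σ : Sub k n) → FVsub (τ ∘ σ) ⊆ FVsub σ
  fv-∘ ⟨ τ , u ⟩ σ (fv-here p) = fv-[]tm u σ p
  fv-∘ ⟨ τ , u ⟩ σ (fv-there p) = fv-∘ τ σ p

fv-[]ty : (A : Ty k) (σ : Sub k n) → FVty (A [ σ ]ty) ⊆ FVsub σ
fv-[]ty (s ─⟨ A ⟩⟶ t) σ (fv-src p) = fv-[]tm s σ p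
fv-[]ty (s ─⟨ A ⟩⟶ t) σ (fv-ty p) = fv-[]ty A σ p
fv-[]ty (s ─⟨ A ⟩⟶ t) σ (fv-tgt p) = fv-[]tm t σ p

fv-entry : (σ : Sub k n) {x : Fin n} → x ∈FVsub σ → Σ (Fin k) λ y → x ∈FVtm lookupSub σ y
fv-entry ⟨ σ , t ⟩ (fv-here p) = zero , p
fv-entry ⟨ σ , t ⟩ (fv-there p) with fv-entry σ p
... | y , q = suc y , q

mutual
  fv-[]tm-entry : (u : Tm k) (σ : Sub k n) {y : Fin k} → y ∈FVtm u →
                  FV (lookupSub σ y) ⊆ FV (u [ σ ]tm)
  fv-[]tm-entry (var z) σ fv-var p = p
  fv-[]tm-entry (coh Δ A τ) σ (fv-coh q) p = fv-coh (fv-∘-entry τ σ q p)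

  fv-∘-entry : (τ : Sub j k) (σ : Sub k n) {y : Fin k} → y ∈FVsub τ →
               FV (lookupSub σ y) ⊆ FVsub (τ ∘ σ)
  fv-∘-entry ⟨ τ , u ⟩ σ (fv-here q) p = fv-here (fv-[]tm-entry u σ q p)
  fv-∘-entry ⟨ τ , u ⟩ σ (fv-there q) p = fv-there (fv-∘-entry τ σ q p)

fv-[]ty-entry : (A : Ty k) (σ : Sub k n) {y : Fin k} → y ∈FVty A →
                FV (lookupSub σ y) ⊆ FVty (A [ σ ]ty)
fv-[]ty-entry (s ─⟨ A ⟩⟶ t) σ (fv-src q) p = fv-src (fv-[]tm-entry s σ q p)
fv-[]ty-entry (s ─⟨ A ⟩⟶ t) σ (fv-ty q) p = fv-ty (fv-[]ty-entry A σ q p)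
fv-[]ty-entry (s ─⟨ A ⟩⟶ t) σ (fv-tgt q) p = fv-tgt (fv-[]tm-entry t σ q p)

sameSupp-coh : {Γ : Ctx n} {Δ : Ctx k} {Δ' : Ctx m} {A : Ty k} {B : Ty m}
               {σ : Sub k n} {τ : Sub m n} →
               SameSupp Γ (FVsub σ) (FVsub τ) → SameSupp Γ (FV (coh Δ A σ)) (FV (coh Δ' B τ))
sameSupp-coh e =
  sameSupp (λ { (fv-coh p) → closure-mono fv-coh (sameSupp⇒⊆ e p) })
           (λ { (fv-coh p) → closure-mono fv-coh (sameSupp⇒⊆ (≐-sym e) p) })

sameSupp-ext : {Γ : Ctx n} {σ τ : Sub k n} {s t : Tm n} →
               SameSupp Γ (FVsub σ) (FVsub τ) → SameSupp Γ (FV s) (FV t) →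
               SameSupp Γ (FVsub ⟨ σ , s ⟩) (FVsub ⟨ τ , t ⟩)
sameSupp-ext eσ es =
  sameSupp (λ { (fv-here p) → closure-mono fv-here (sameSupp⇒⊆ es p)
              ; (fv-there p) → closure-mono fv-there (sameSupp⇒⊆ eσ p) })
           (λ { (fv-here p) → closure-mono fv-here (sameSupp⇒⊆ (≐-sym es) p)
              ; (fv-there p) → closure-mono fv-there (sameSupp⇒⊆ (≐-sym eσ) p) })

data TySupp (Γ : Ctx n) : Ty n → Ty n → Set where
  ⋆-supp   : TySupp Γ ⋆ ⋆
  arr-supp : {s s' t t' : Tm n} {A A' : Ty n} →
             SameSupp Γ (FV s) (FV s') → TySupp Γ A A' → SameSupp Γ (FV t) (FV t') →
             TySupp Γ (s ─⟨ A ⟩⟶ t) (s' ─⟨ A' ⟩⟶ t')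

module _ {Γ : Ctx n} where

  tySupp-refl : (A : Ty n) → TySupp Γ A A
  tySupp-refl ⋆ = ⋆-supp
  tySupp-refl (s ─⟨ A ⟩⟶ t) = arr-supp ≐-refl (tySupp-refl A) ≐-refl

  tySupp-sym : {A B : Ty n} → TySupp Γ A B → TySupp Γ B A
  tySupp-sym ⋆-supp = ⋆-supp
  tySupp-sym (arr-supp a b c) = arr-supp (≐-sym a) (tySupp-sym b) (≐-sym c)

  tySupp-trans : {A B C : Ty n} → TySupp Γ A B → TySupp Γ B C → TySupp Γ A C
  tySupp-trans ⋆-supp ⋆-supp = ⋆-supp
  tySupp-trans (arr-supp a b c) (arr-supp a' b' c') =
    arr-supp (≐-trans a a') (tySupp-trans b b') (≐-trans c c')

  tySupp-⊆ : {A B : Ty n} → TySupp Γ A B → FVty A ⊆ Closure Γ (FVty B)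
  tySupp-⊆ (arr-supp a b c) (fv-src p) = closure-mono fv-src (sameSupp⇒⊆ a p)
  tySupp-⊆ (arr-supp a b c) (fv-ty p) = closure-mono fv-ty (tySupp-⊆ b p)
  tySupp-⊆ (arr-supp a b c) (fv-tgt p) = closure-mono fv-tgt (sameSupp⇒⊆ c p)

syntacticTy : Ctx n → Tm n → Ty n
syntacticTy Γ (var x) = varTy Γ x
syntacticTy Γ (coh Δ A σ) = A [ σ ]ty

syntacticTy-supported : {Γ : Ctx n} (t : Tm n) → FVty (syntacticTy Γ t) ⊆ Closure Γ (FV t)
syntacticTy-supported (var x) q = cl-ty (cl-in fv-var) q
syntacticTy-supported (coh Δ A σ) q = cl-in (fv-coh (fv-[]ty A σ q))

Supported : Ctx n → Sub k n → Ctx k → Set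
Supported Γ σ Δ = ∀ x → FVty (varTy Δ x [ σ ]ty) ⊆ Closure Γ (FV (lookupSub σ x))

-- The support side condition of the coherence rule, together with the
-- nonemptiness of FV(source), which holds for any well-typed source.
CohCond : Ctx k → Ty k → Set
CohCond Δ ⋆ = ⊥
CohCond Δ (s ─⟨ A ⟩⟶ t) =
  (Σ _ λ z → z ∈FVtm s) ×
  (((Supp Δ s ≐ ∂⁻ Δ) × (Supp Δ t ≐ ∂⁺ Δ))
    ⊎ ((Supp Δ s ≐ (λ _ → ⊤)) × (Supp Δ t ≐ (λ _ → ⊤))))

InnerSupported : Ctx n → Tm n → Set
InnerSupported Γ (var x) = ⊤
InnerSupported Γ (coh Δ B σ) = Supported Γ σ Δ

EntryInfo : Ctx n → Sub k n → Ctx k → Set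
EntryInfo Γ σ Δ = ∀ x → TySupp Γ (varTy Δ x [ σ ]ty) (syntacticTy Γ (lookupSub σ x))
                      × InnerSupported Γ (lookupSub σ x)

CohInfo : Ctx n → Tm n → Set
CohInfo Γ (var x) = ⊤
CohInfo Γ (coh Δ B σ) = EntryInfo Γ σ Δ × (Δ ⊢pc) × CohCond Δ B

Info : Ctx n → Tm n → Ty n → Set
Info Γ t A = TySupp Γ A (syntacticTy Γ t) × CohInfo Γ t

entryInfo⇒supported : {Γ : Ctx n} {σ : Sub k n} {Δ : Ctx k} →
                      EntryInfo Γ σ Δ → Supported Γ σ Δ
entryInfo⇒supported {σ = σ} info x p =
  closure-bind (syntacticTy-supported (lookupSub σ x)) (tySupp-⊆ (proj₁ (info x)) p)

cohInfo⇒innerSupported : {Γ : Ctx n} (t : Tm n) → CohInfo Γ t → InnerSupported Γ t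
cohInfo⇒innerSupported (var x) _ = tt
cohInfo⇒innerSupported (coh Δ B σ) (info , _) = entryInfo⇒supported {Δ = Δ} info

-- Pasting contexts are nonempty, hence so is FV(t) for a well-typed t.
pasting-nonempty : {Γ : Ctx zero} {x : Tm zero} {A : Ty zero} → Γ ⊢p x ∶ A → ⊥
pasting-nonempty (ps-descent D) = pasting-nonempty D

typed-fv-nonempty : {Γ : Ctx n} {t : Tm n} {A : Ty n} → Γ ⊢ t ∶ A → Σ _ λ z → z ∈FVtm t
typed-fv-nonempty (tm-var x) = x , fv-var
typed-fv-nonempty (tm-conv d _) = typed-fv-nonempty d
typed-fv-nonempty (tm-coh (pasting D) _ sub-⟨⟩ _) = ⊥-elim (pasting-nonempty D)
typed-fv-nonempty (tm-coh _ _ (sub-ext _ _ d) _) with typed-fv-nonempty d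
... | z , q = z , fv-coh (fv-here q)

VarArrows : Ctx n → Ty n → Set
VarArrows Γ ⋆ = ⊤
VarArrows Γ (var i ─⟨ B ⟩⟶ var j) = (varTy Γ i ≡ B) × (varTy Γ j ≡ B) × VarArrows Γ B
VarArrows Γ (var i ─⟨ B ⟩⟶ coh _ _ _) = ⊥
VarArrows Γ (coh _ _ _ ─⟨ B ⟩⟶ _) = ⊥

varArrows-wk : {Γ : Ctx n} {C : Ty n} (A : Ty n) → VarArrows Γ A → VarArrows (Γ ▸ C) (wkTy A)
varArrows-wk ⋆ _ = tt
varArrows-wk (var i ─⟨ B ⟩⟶ var j) (ei , ej , w) = cong wkTy ei , cong wkTy ej , varArrows-wk B w

PastingVar : Ctx n → Tm n → Ty n → Set
PastingVar {n} Γ x A = Σ (Fin n) λ i → (x ≡ var i) × (varTy Γ i ≡ A) × VarArrows Γ A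

pastingVar : {Γ : Ctx n} {x : Tm n} {A : Ty n} → Γ ⊢p x ∶ A → PastingVar Γ x A
pastingVar ps-base = zero , refl , refl , tt
pastingVar (ps-intro D) with pastingVar D
... | i , refl , refl , w = zero , refl , refl , (refl , refl , varArrows-wk _ (varArrows-wk _ w))
pastingVar (ps-descent D) with pastingVar D
pastingVar (ps-descent {x = var _} {y = var j} D) | _ , refl , _ , (_ , ej , w) = j , refl , ej , w

-- Dimensions shifted by one, as natural numbers: lv A = dim A + 1 and
-- ctxLevel Γ = dim Γ + 1 for nonempty Γ.
lv : Ty n → ℕ
lv = discLevel

lv-ren : (ρ : Fin n → Fin m) (A : Ty n) → lv (renTy ρ A) ≡ lv A
lv-ren ρ ⋆ = refl
lv-ren ρ (s ─⟨ A ⟩⟶ t) = cong suc (lv-ren ρ A)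

lv-wk² : (A : Ty n) → lv (wkTy (wkTy A)) ≡ lv A
lv-wk² A = trans (lv-ren suc (wkTy A)) (lv-ren suc A)

ctxLevel : Ctx n → ℕ
ctxLevel ∅ = 0
ctxLevel (Γ ▸ A) = ctxLevel Γ ⊔ lv A

dimTy≡lv : (A : Ty n) → dimTy A Z.+ + 1 ≡ + lv A
dimTy≡lv ⋆ = refl
dimTy≡lv (s ─⟨ A ⟩⟶ t) = trans (cong (Z._+ + 1) (dimTy≡lv A)) (cong +_ (ℕ.+-comm (lv A) 1))

dimCtx≡ctxLevel : (Γ : Ctx (suc n)) → dimCtx Γ ≡ + ctxLevel Γ
dimCtx≡ctxLevel (∅ ▸ A) = cong (dimCtx ∅ Z.⊔_) (dimTy≡lv A)
dimCtx≡ctxLevel (Γ ▸ B ▸ A) =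
  cong₂ Z._⊔_ (dimCtx≡ctxLevel (Γ ▸ B)) (dimTy≡lv A)

ctxLevel-intro : (Γ : Ctx n) (A : Ty n) (s t : Tm (suc n)) →
                 ctxLevel (Γ ▸ A ▸ (s ─⟨ wkTy A ⟩⟶ t)) ≡ ctxLevel Γ ⊔ suc (lv A)
ctxLevel-intro Γ A s t = begin
  (N ⊔ lv A) ⊔ suc (lv (wkTy A)) ≡⟨ cong (λ l → (N ⊔ lv A) ⊔ suc l) (lv-ren suc A) ⟩
  (N ⊔ lv A) ⊔ suc (lv A)        ≡⟨ ℕ.⊔-assoc N (lv A) (suc (lv A)) ⟩
  N ⊔ (lv A ⊔ suc (lv A))        ≡⟨ cong (N ⊔_) (ℕ.m≤n⇒m⊔n≡n (ℕ.n≤1+n (lv A))) ⟩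
  N ⊔ suc (lv A)                 ∎
  where
    open ≡-Reasoning
    N : ℕ
    N = ctxLevel Γ

varArrows-source : {Γ : Ctx n} {y : Fin n} {B : Ty n} (t : Tm n) →
                   VarArrows Γ (var y ─⟨ B ⟩⟶ t) → varTy Γ y ≡ B
varArrows-source (var j) (e , _) = e

wk²-source-new : (A : Ty n) {B : Ty (suc (suc n))} {t : Tm (suc (suc n))} →
                 ¬ (wkTy (wkTy A) ≡ (var (suc zero) ─⟨ B ⟩⟶ t))
wk²-source-new (var j ─⟨ A ⟩⟶ u) ()

wk²-source-old : (A : Ty n) {y : Fin n} {B : Ty (suc (suc n))} {t : Tm (suc (suc n))} →
                 wkTy (wkTy A) ≡ (var (suc (suc y)) ─⟨ B ⟩⟶ t) →
                 Σ (Ty n) λ B' → Σ (Tm n) λ t' → A ≡ (var y ─⟨ B' ⟩⟶ t')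
wk²-source-old (var j ─⟨ B ⟩⟶ u) refl = B , u , refl

introCtx : (Γ : Ctx n) → Ty n → Fin n → Ctx (suc (suc n))
introCtx Γ A i = Γ ▸ A ▸ (var (suc i) ─⟨ wkTy A ⟩⟶ var zero)

module _ (Γ : Ctx n) (A : Ty n) (i : Fin n) where

  introTarget-notSource : ¬ IsSourceOfSome (introCtx Γ A i) (suc zero)
  introTarget-notSource (suc zero , _ , _ , e) = wk²-source-new A e
  introTarget-notSource (suc (suc g) , _ , _ , e) = wk²-source-new (varTy Γ g) e

  introSources : {z : Fin n} → IsSourceOfSome (introCtx Γ A i) (suc (suc z)) →
                 (z ≡ i) ⊎ (Σ (Ty n) λ B → Σ (Tm n) λ t → A ≡ (var z ─⟨ B ⟩⟶ t))
                         ⊎ IsSourceOfSome Γ z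
  introSources (zero , _ , _ , refl) = inj₁ refl
  introSources (suc zero , _ , _ , e) = inj₂ (inj₁ (wk²-source-old A e))
  introSources (suc (suc g) , _ , _ , e) with wk²-source-old (varTy Γ g) e
  ... | B , t , e' = inj₂ (inj₂ (g , t , B , e'))

-- Either Γ has dimension 0, or some variable of dimension dim Γ - 1 is the
-- target but not the source of an arrow; this separates ∂⁻Γ from ∂⁺Γ.
TopTarget : Ctx n → Set
TopTarget {n} Γ = (ctxLevel Γ ≡ 0) ⊎
  (Σ (Fin n) λ y → (suc (lv (varTy Γ y)) ≡ ctxLevel Γ)
                   × IsTargetOfSome Γ y × ¬ IsSourceOfSome Γ y)

topTarget-grows : (Γ : Ctx n) (A : Ty n) (i : Fin n) → ctxLevel Γ ≤ suc (lv A) →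
                  TopTarget (introCtx Γ A i)
topTarget-grows Γ A i grows =
  inj₂ (suc zero , level , (zero , _ , _ , refl) , introTarget-notSource Γ A i)
  where
    open ≡-Reasoning
    level : suc (lv (wkTy (wkTy A))) ≡ ctxLevel (introCtx Γ A i)
    level = begin
      suc (lv (wkTy (wkTy A))) ≡⟨ cong suc (lv-wk² A) ⟩
      suc (lv A)               ≡⟨ ℕ.m≤n⇒m⊔n≡n grows ⟨
      ctxLevel Γ ⊔ suc (lv A)  ≡⟨ ctxLevel-intro Γ A (var (suc i)) (var zero) ⟨
      _                        ∎

-- Otherwise an old top target y₀ stays one: it cannot be x or the source of
-- A, whose dimensions are too high, since y₀'s dimension is that of Γ minus one.
topTarget-stays : {Γ : Ctx n} {A : Ty n} {i : Fin n} → varTy Γ i ≡ A → VarArrows Γ A →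
                  suc (lv A) < ctxLevel Γ → TopTarget Γ → TopTarget (introCtx Γ A i)
topTarget-stays {A = A} _ _ lt (inj₁ level0) = ⊥-elim (ℕ.n≮0 (subst (suc (lv A) <_) level0 lt))
topTarget-stays {Γ = Γ} {A} {i} eA wA lt (inj₂ (y , top , (g , s , B , eTgt) , notSource)) =
  inj₂ (suc (suc y) , level , (suc (suc g) , wkTm (wkTm s) , wkTy (wkTy B) ,
        cong (λ C → wkTy (wkTy C)) eTgt) , notSource⁺)
  where
    open ≡-Reasoning
    level : suc (lv (wkTy (wkTy (varTy Γ y)))) ≡ ctxLevel (introCtx Γ A i)
    level = begin
      suc (lv (wkTy (wkTy (varTy Γ y)))) ≡⟨ cong suc (lv-wk² (varTy Γ y)) ⟩
      suc (lv (varTy Γ y))               ≡⟨ top ⟩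
      ctxLevel Γ                         ≡⟨ ℕ.m≥n⇒m⊔n≡m (ℕ.<⇒≤ lt) ⟨
      ctxLevel Γ ⊔ suc (lv A)            ≡⟨ ctxLevel-intro Γ A (var (suc i)) (var zero) ⟨
      _                                  ∎
    notSource⁺ : ¬ IsSourceOfSome (introCtx Γ A i) (suc (suc y))
    notSource⁺ src with introSources Γ A i src
    ... | inj₁ refl = ℕ.<-irrefl (trans (cong (λ C → suc (lv C)) (sym eA)) top) lt
    ... | inj₂ (inj₁ (B' , t' , refl)) =
      ℕ.<-irrefl (trans (cong (λ C → suc (lv C)) (sym (varArrows-source t' wA))) top)
                 (ℕ.<-trans (ℕ.n<1+n _) lt)
    ... | inj₂ (inj₂ src') = notSource src'

topTarget : {Γ : Ctx n} {x : Tm n} {A : Ty n} → Γ ⊢p x ∶ A → TopTarget Γ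
topTarget ps-base = inj₁ refl
topTarget (ps-intro {Γ = Γ} {A = A} D) with pastingVar D
... | i , refl , eA , wA with ctxLevel Γ ≤? suc (lv A)
...   | yes grows = topTarget-grows Γ A i grows
...   | no stays = topTarget-stays eA wA (ℕ.≰⇒> stays) (topTarget D)
topTarget (ps-descent D) = topTarget D

-- Translating TopTarget back to the integer dimensions used by ∂⁻ and ∂⁺.
-- In dimension 0 the boundary dimension dim Δ - 1 is -1, below every variable.
level0-boundaryDim : (Δ : Ctx (suc k)) → ctxLevel Δ ≡ 0 → dimCtx Δ Z.- + 1 ≡ -[1+ 0 ]
level0-boundaryDim Δ level0 = cong (Z._- + 1) (trans (dimCtx≡ctxLevel Δ) (cong +_ level0))

level0-∂⁻-empty : (Δ : Ctx (suc k)) {z : Fin (suc k)} → ctxLevel Δ ≡ 0 → ¬ ∂⁻ Δ z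
level0-∂⁻-empty Δ {z} level0 (inj₁ lt)
  with subst₂ Z._<_ (dimTy≡lv (varTy Δ z)) (level0-boundaryDim Δ level0) lt
... | ()
level0-∂⁻-empty Δ {z} level0 (inj₂ (e , _))
  with trans (sym (dimTy≡lv (varTy Δ z))) (trans e (level0-boundaryDim Δ level0))
... | ()

topLevel-dim : (Δ : Ctx (suc k)) (y : Fin (suc k)) → suc (lv (varTy Δ y)) ≡ ctxLevel Δ →
               dimVar Δ y ≡ dimCtx Δ Z.- + 1
topLevel-dim Δ y top = begin
  dimVar Δ y                        ≡⟨ dimTy≡lv (varTy Δ y) ⟩
  + suc (lv (varTy Δ y)) Z.- + 1    ≡⟨ cong (λ l → + l Z.- + 1) top ⟩
  + ctxLevel Δ Z.- + 1              ≡⟨ cong (Z._- + 1) (dimCtx≡ctxLevel Δ) ⟨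
  dimCtx Δ Z.- + 1                  ∎
  where open ≡-Reasoning

-- For a pasting context Δ, no term with a free variable has support both
-- ∂⁻Δ and ∂⁺Δ: a top target lies in ∂⁺Δ but not in ∂⁻Δ.
boundaries-differ : {Δ : Ctx k} {t : Tm k} → Δ ⊢pc → (Σ _ λ z → z ∈FVtm t) →
                    Supp Δ t ≐ ∂⁻ Δ → Supp Δ t ≐ ∂⁺ Δ → ⊥
boundaries-differ {k = suc k} {Δ = Δ} (pasting D) (z , q) e⁻ e⁺ with topTarget D
... | inj₁ level0 = level0-∂⁻-empty Δ level0 (proj₁ (e⁻ z) (supp-fv q))
... | inj₂ (y , top , isTarget , notSource)
  with proj₁ (e⁻ y) (proj₂ (e⁺ y) (inj₂ (topLevel-dim Δ y top , notSource)))
...   | inj₁ lt = ZP.<-irrefl (topLevel-dim Δ y top) lt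
...   | inj₂ (_ , notTarget) = notTarget isTarget

record PruneShape {Γ : Ctx n} {x : Tm n} {A : Ty n} {D : Γ ⊢p x ∶ A} {α : Fin n}
                  (lm : LocMax D α) : Set where
  field
    src tgt       : Fin n
    base          : Ty n
    α-type        : varTy Γ α ≡ (var src ─⟨ base ⟩⟶ var tgt)
    keeps-src     : (σ : Sub n m) → FV (lookupSub σ src) ⊆ FVsub (prSub lm σ)
    prune-⊆       : (σ : Sub n m) → FVsub (prSub lm σ) ⊆ FVsub σ
    prune-deletes : (σ : Sub n m) {z : Fin m} → z ∈FVsub σ →
                    z ∈FVsub prSub lm σ ⊎ (z ∈FVtm lookupSub σ α ⊎ z ∈FVtm lookupSub σ tgt)

pruneShape : {Γ : Ctx n} {x : Tm n} {A : Ty n} {D : Γ ⊢p x ∶ A} {α : Fin n}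
             (lm : LocMax D α) → PruneShape lm
pruneShape (lm-here D) with pastingVar D
... | i , refl , _ = record
  { src = suc (suc i) ; tgt = suc zero ; base = _ ; α-type = refl
  ; keeps-src = λ { ⟨ ⟨ σ , _ ⟩ , _ ⟩ p → fv-lookup σ i p }
  ; prune-⊆ = λ { ⟨ ⟨ σ , _ ⟩ , _ ⟩ p → fv-there (fv-there p) }
  ; prune-deletes = λ { ⟨ ⟨ σ , _ ⟩ , _ ⟩ (fv-here p) → inj₂ (inj₁ p)
                      ; ⟨ ⟨ σ , _ ⟩ , _ ⟩ (fv-there (fv-here p)) → inj₂ (inj₂ p)
                      ; ⟨ ⟨ σ , _ ⟩ , _ ⟩ (fv-there (fv-there p)) → inj₁ p } }
pruneShape (lm-desc lm) = record { Shape }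
  where module Shape = PruneShape (pruneShape lm)
pruneShape (lm-intro {α = α} lm) = record
  { src = suc (suc src) ; tgt = suc (suc tgt) ; base = wkTy (wkTy base)
  ; α-type = cong (λ C → wkTy (wkTy C)) α-type
  ; keeps-src = λ { ⟨ ⟨ σ , _ ⟩ , _ ⟩ p → fv-there (fv-there (keeps-src σ p)) }
  ; prune-⊆ = λ { ⟨ ⟨ σ , _ ⟩ , _ ⟩ (fv-here p) → fv-here p
                ; ⟨ ⟨ σ , _ ⟩ , _ ⟩ (fv-there (fv-here p)) → fv-there (fv-here p)
                ; ⟨ ⟨ σ , _ ⟩ , _ ⟩ (fv-there (fv-there p)) → fv-there (fv-there (prune-⊆ σ p)) }
  ; prune-deletes = deletes }
  where
    open PruneShape (pruneShape lm)
    deletes : (σ : Sub _ m) {z : Fin m} → z ∈FVsub σ →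
              z ∈FVsub prSub (lm-intro lm) σ
              ⊎ (z ∈FVtm lookupSub σ (suc (suc α)) ⊎ z ∈FVtm lookupSub σ (suc (suc tgt)))
    deletes ⟨ ⟨ σ , _ ⟩ , _ ⟩ (fv-here p) = inj₁ (fv-here p)
    deletes ⟨ ⟨ σ , _ ⟩ , _ ⟩ (fv-there (fv-here p)) = inj₁ (fv-there (fv-here p))
    deletes ⟨ ⟨ σ , _ ⟩ , _ ⟩ (fv-there (fv-there p)) with prune-deletes σ p
    ... | inj₁ q = inj₁ (fv-there (fv-there q))
    ... | inj₂ r = inj₂ r

-- (disc) A supported substitution out of the disc D^k is supported by the
-- entry of its top variable d_k, whose type contains all the others.
disc-supported : {Γ : Ctx n} (k : ℕ) (τ : Sub (discSize k) n) → Supported Γ τ (Disc k) →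
                 FVsub τ ⊆ Closure Γ (FV (lookupSub τ zero))
disc-supported zero ⟨ ⟨⟩ , b ⟩ sup (fv-here p) = cl-in p
disc-supported (suc k) ⟨ ⟨ τ , a ⟩ , b ⟩ sup (fv-here p) = cl-in p
disc-supported (suc k) ⟨ ⟨ τ , a ⟩ , b ⟩ sup (fv-there (fv-here p)) = sup zero (fv-tgt p)
disc-supported {Γ = Γ} (suc k) ⟨ ⟨ τ , a ⟩ , b ⟩ sup (fv-there (fv-there p)) =
  closure-bind (λ q → sup zero (fv-src q)) (disc-supported k τ sup-τ p)
  where
    sup-τ : Supported Γ τ (Disc k)
    sup-τ y q = sup (suc (suc y))
                    (subst (λ C → _ ∈FVty C) (sym (wk²-[]ty (varTy (Disc k) y) τ a b)) q)

disc-support : {Γ : Ctx n} (k : ℕ) {A : Ty (discSize k)} (σ : Sub (discSize k) n) →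
               Supported Γ σ (Disc k) → SameSupp Γ (FV (coh (Disc k) A σ)) (FV (lookupSub σ zero))
disc-support k σ sup =
  sameSupp (λ { (fv-coh p) → disc-supported k σ sup p }) (λ p → cl-in (fv-coh (fv-lookup σ zero p)))

supp-[] : {Γ : Ctx n} {Δ : Ctx k} {t : Tm k} {σ : Sub k n} {y : Fin k} →
          Supported Γ σ Δ → Supp Δ t y → FV (lookupSub σ y) ⊆ Closure Γ (FV (t [ σ ]tm))
supp-[] {t = t} {σ = σ} sup (supp-fv q) p = cl-in (fv-[]tm-entry t σ q p)
supp-[] {Δ = Δ} {σ = σ} sup (supp-ty {x = x} s q) p =
  closure-bind (supp-[] sup s) (sup x (fv-[]ty-entry (varTy Δ x) σ q p))

-- (endo) For a well-formed coherence t → t over a pasting context, the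
-- boundary case of the side condition is impossible, so supp(t) is all of Δ
-- and σ is supported by t[σ], the top entry of {A, t} ∘ σ.
endo-support : {Γ : Ctx n} {Δ : Ctx k} {t : Tm k} {A : Ty k} {σ : Sub k n} →
               Δ ⊢pc → Supported Γ σ Δ → CohCond Δ (t ─⟨ A ⟩⟶ t) →
               SameSupp Γ (FVsub σ) (FVsub (discSub A t ∘ σ))
endo-support pc sup (nonempty , inj₁ (e⁻ , e⁺)) = ⊥-elim (boundaries-differ pc nonempty e⁻ e⁺)
endo-support {t = t} {A = A} {σ = σ} pc sup (_ , inj₂ (full , _)) =
  sameSupp covered (λ p → cl-in (fv-∘ (discSub A t) σ p))
  where
    top : (B : Ty _) → FV (t [ σ ]tm) ⊆ FVsub (discSub B t ∘ σ)
    top ⋆ p = fv-here p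
    top (_ ─⟨ _ ⟩⟶ _) p = fv-here p
    covered : FVsub σ ⊆ Closure _ (FVsub (discSub A t ∘ σ))
    covered p with fv-entry σ p
    ... | y , q = closure-mono (top A) (supp-[] sup (proj₂ (full y) tt) q)

-- An identity i_k[τ] of a type with the support of s → t (τ supported) is,
-- like t, supported by s: all of τ is supported by its top entry d_k[τ],
-- which has the same support as both s and t.
identity-support : {Γ : Ctx n} {s t : Tm n} {B : Ty n} (k : ℕ) (τ : Sub (discSize k) n) →
                   TySupp Γ (s ─⟨ B ⟩⟶ t) (syntacticTy Γ (idTm k τ)) → Supported Γ τ (Disc k) →
                   (FV (idTm k τ) ⊆ Closure Γ (FV s)) × (FV t ⊆ Closure Γ (FV s))
identity-support {Γ = Γ} {s = s} k τ (arr-supp s∼d _ t∼d) sup =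
  (λ { (fv-coh p) → toSource (disc-supported k τ sup p) }) ,
  (λ p → toSource (sameSupp⇒⊆ t∼d p))
  where
    toSource : Closure Γ (FV (lookupSub τ zero)) ⊆ Closure Γ (FV s)
    toSource = closure-bind (sameSupp⇒⊆ (≐-sym s∼d))

-- (prune) If α[σ] is an identity, the entries of α and its target deleted
-- by pruning are supported by the kept entry of its source.
prune-support : {Γ : Ctx n} {Δ : Ctx k} {x : Tm k} {B : Ty k} {D : Δ ⊢p x ∶ B} {α : Fin k}
                (lm : LocMax D α) (σ : Sub k n) → EntryInfo Γ σ Δ →
                IsIdentity (lookupSub σ α) → SameSupp Γ (FVsub σ) (FVsub (prSub lm σ))
prune-support {Γ = Γ} {Δ = Δ} {α = α} lm σ info (j , τ , isId) =
  sameSupp covered (λ p → cl-in (prune-⊆ σ p))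
  where
    open PruneShape (pruneShape lm)
    αInfo : TySupp Γ (varTy Δ α [ σ ]ty) (syntacticTy Γ (idTm j τ)) × Supported Γ τ (Disc j)
    αInfo = subst (λ u → TySupp Γ (varTy Δ α [ σ ]ty) (syntacticTy Γ u) × InnerSupported Γ u)
                  isId (info α)
    idSupp : (FV (idTm j τ) ⊆ Closure Γ (FV (lookupSub σ src)))
           × (FV (lookupSub σ tgt) ⊆ Closure Γ (FV (lookupSub σ src)))
    idSupp = identity-support j τ (subst (λ C → TySupp Γ (C [ σ ]ty) _) α-type (proj₁ αInfo))
                              (proj₂ αInfo)
    toKept : Closure Γ (FV (lookupSub σ src)) ⊆ Closure Γ (FVsub (prSub lm σ))
    toKept = closure-bind (λ q → cl-in (keeps-src σ q))
    covered : FVsub σ ⊆ Closure Γ (FVsub (prSub lm σ))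
    covered p with prune-deletes σ p
    ... | inj₁ q = cl-in q
    ... | inj₂ (inj₁ q) = toKept (proj₁ idSupp (subst (λ u → _ ∈FVtm u) isId q))
    ... | inj₂ (inj₂ q) = toKept (proj₂ idSupp q)

mutual
  typing-info : {Γ : Ctx n} {t : Tm n} {A : Ty n} → Γ ⊢ t ∶ A → Info Γ t A
  typing-info (tm-var x) = tySupp-refl _ , tt
  typing-info (tm-conv d e) =
    tySupp-trans (tySupp-sym (tyEq-support e)) (proj₁ (typing-info d)) , proj₂ (typing-info d)
  typing-info {Γ = Γ} (tm-coh {Δ = Δ} {σ = σ} pc (ty-arr _ ds _) sd cond) =
    tySupp-refl _ , (entries , pc , typed-fv-nonempty ds , cond)
    where
      entries : EntryInfo Γ σ Δ
      entries x = proj₁ (sub-info sd x) ,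
                  cohInfo⇒innerSupported (lookupSub σ x) (proj₂ (sub-info sd x))

  sub-info : {Γ : Ctx n} {σ : Sub k n} {Δ : Ctx k} → Γ ⊢sub σ ∶ Δ →
             (x : Fin k) → Info Γ (lookupSub σ x) (varTy Δ x [ σ ]ty)
  sub-info {Γ = Γ} (sub-ext {σ = σ} {A = A} {t = t} _ _ d) zero =
    subst (Info Γ t) (sym (wk-[]ty A σ t)) (typing-info d)
  sub-info {Γ = Γ} (sub-ext {σ = σ} {Δ = Δ} {t = t} sd _ _) (suc x) =
    subst (Info Γ (lookupSub σ x)) (sym (wk-[]ty (varTy Δ x) σ t)) (sub-info sd x)

  eq-support : {Γ : Ctx n} {s t : Tm n} → Γ ⊢ s ≈ t → SameSupp Γ (FV s) (FV t)
  eq-support (eq-var x) = ≐-refl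
  eq-support (eq-sym e) = ≐-sym (eq-support e)
  eq-support (eq-trans e f) = ≐-trans (eq-support e) (eq-support f)
  eq-support (eq-coh _ e) = sameSupp-coh (subEq-support e)
  eq-support (eq-prune {σ = σ} (_ , d) (pasting D) lm isId) with typing-info d
  ... | _ , (info , _) = sameSupp-coh (prune-support lm σ info isId)
  eq-support (eq-disc {m = m} {σ = σ} (_ , d)) with typing-info d
  ... | _ , (info , _) = disc-support (suc m) σ (entryInfo⇒supported {Δ = Disc (suc m)} info)
  eq-support (eq-endo {Δ = Δ} (_ , d)) with typing-info d
  ... | _ , (info , pc , cond) =
    sameSupp-coh (endo-support pc (entryInfo⇒supported {Δ = Δ} info) cond)

  tyEq-support : {Γ : Ctx n} {A B : Ty n} → Γ ⊢ty A ≈ B → TySupp Γ A B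
  tyEq-support tyeq-⋆ = ⋆-supp
  tyEq-support (tyeq-arr s A t) = arr-supp (eq-support s) (tyEq-support A) (eq-support t)

  subEq-support : {Γ : Ctx n} {σ τ : Sub k n} → Γ ⊢sub σ ≈ τ → SameSupp Γ (FVsub σ) (FVsub τ)
  subEq-support subeq-⟨⟩ = ≐-refl
  subEq-support (subeq-ext σ t) = sameSupp-ext (subEq-support σ) (eq-support t)

mainTheorem14 : {n : ℕ} (Γ : Ctx n) (s t : Tm n) →
    Γ ⊢ s ≈ t → Supp Γ s ≐ Supp Γ t
mainTheorem14 Γ s t e x =
  (λ p → closure⇒supp (proj₁ (eq-support e x) (supp⇒closure p))) ,
  (λ p → closure⇒supp (proj₂ (eq-support e x) (supp⇒closure p)))
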